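{- Let $(P,\le)$ be a poset. Then the multiset projectivity relation $<<$ is a partial order on the set $P^\#$ of finite multisets of $P$.
   Context: A finite multiset of $P$ is a map $M\colon B\to\omega\setminus\{0\}$ with $B$ a finite subset of $P$; $M(b)$ is the number of occurrences of $b$ in $M$, and an element of $M$ means a specific occurrence. A map $f\colon M\to N$ between finite multisets assigns to each occurrence in $M$ exactly one occurrence in $N$; it is surjective if every occurrence of $N$ is the image of some occurrence of $M$. For $M,N\in P^\#$, $N<<M$ iff there is a surjective map $f\colon M\to N$ with $f(p)\le p$ for every (occurrence) $p\in M$. -}

module Defs where

open import Level using (Level; _⊔_)
open import Data.List using (List; length; lookup)
open import Data.Fin using (Fin)
open import Data.Product using (Σ; ∃; _×_)
open import Relation.Binary.Bundles using (Poset)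
open import Relation.Binary.PropositionalEquality using (_≡_)
import Data.List.Relation.Binary.Permutation.Setoid as Perm

-- Finite multisets of P are represented as lists of elements of P,
-- considered up to permutation (w.r.t. the poset's equality _≈_).
-- The occurrences of a multiset M are the positions Fin (length M).

module _ {c ℓ₁ ℓ₂ : Level} (P : Poset c ℓ₁ ℓ₂) where
  open Poset P

  Multiset : Set c
  Multiset = List Carrier

  _≈#_ : Multiset → Multiset → Set (c ⊔ ℓ₁)
  _≈#_ = Perm._↭_ Eq.setoid

  _≪_ : Multiset → Multiset → Set ℓ₂
  N ≪ M = Σ (Fin (length M) → Fin (length N)) λ f →
            (∀ (j : Fin (length N)) → ∃ λ (i : Fin (length M)) → f i ≡ j)
          × (∀ (i : Fin (length M)) → lookup N (f i) ≤ lookup M i)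

{-# OPTIONS --safe #-}
module Submission where

open import Defs
open import Level using (Level)
open import Data.Nat using (ℕ; zero; suc; _+_)
open import Data.Nat.Properties using (+-comm; n<1+n; m≤n⇒∃[o]m+o≡n)
open import Data.Nat.GeneralisedArithmetic using (iterate)
open import Data.Fin using (Fin; zero; suc; punchIn; toℕ)
open import Data.Fin.Properties using (pigeonhole; ¬Fin0)
open import Data.Fin.Permutation
  using (Permutation; _⟨$⟩ʳ_; _⟨$⟩ˡ_; permutation; remove; punchIn-permute; inverseˡ; inverseʳ)
open import Data.List using ([]; _∷_; length; lookup; tabulate)
open import Data.List.Properties using (tabulate-lookup)
open import Data.Product using (Σ-syntax; ∃; _×_; _,_; proj₁; proj₂)
open import Data.Empty using (⊥-elim)
open import Function using (_∘_)
open import Function.Definitions using (Injective; StrictlySurjective)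
open import Relation.Binary.Bundles using (Poset; Setoid)
open import Relation.Binary.Structures using (IsPartialOrder)
open import Relation.Binary.PropositionalEquality using (_≡_; refl; sym; trans; cong; subst; module ≡-Reasoning)
import Data.List.Relation.Binary.Permutation.Setoid as Permutation
import Data.List.Relation.Binary.Permutation.Setoid.Properties as PermutationProperties
import Relation.Binary.Reasoning.PartialOrder as ≤-Reasoning

-- Surjections f : M → N and g : N → M between the occurrence sets have injective
-- sections f⁻ and g⁻, so s = f⁻ ∘ g⁻ is an injective self-map of a finite set;
-- by pigeonhole every point is periodic under s, hence s is a bijection and so is f.
-- Along s the labels of M can only grow, M x ≤ N (g⁻ x) ≤ M (s x), and since the
-- orbit of x returns to x all these labels are equal; so f matches equal labels.

private
  variable
    a c ℓ ℓ₁ ℓ₂ : Level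
    A B : Set a
    m n : ℕ

iterate-+ : ∀ (s : A → A) x i j → iterate s x (i + j) ≡ iterate s (iterate s x i) j
iterate-+ s x zero    j = refl
iterate-+ s x (suc i) j = iterate-+ s (s x) i j

iterate-suc : ∀ (s : A → A) x k → iterate s x (suc k) ≡ s (iterate s x k)
iterate-suc s x zero    = refl
iterate-suc s x (suc k) = iterate-suc s (s x) k

iterate-injective : ∀ {s : A → A} → Injective _≡_ _≡_ s →
                    ∀ k → Injective _≡_ _≡_ (λ x → iterate s x k)
iterate-injective s-injective zero    eq = eq
iterate-injective s-injective (suc k) eq = s-injective (iterate-injective s-injective k eq)

module _ {f : A → B} (f-surjective : StrictlySurjective _≡_ f) where

  section : B → A
  section y = proj₁ (f-surjective y)

  section-inverse : ∀ y → f (section y) ≡ y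
  section-inverse y = proj₂ (f-surjective y)

  section-injective : Injective _≡_ _≡_ section
  section-injective {y} {y′} eq =
    trans (sym (section-inverse y)) (trans (cong f eq) (section-inverse y′))

module _ {s : Fin m → Fin m} (s-injective : Injective _≡_ _≡_ s) where

  collision⇒periodic : ∀ {x} i t → iterate s x i ≡ iterate s x (suc i + t) →
                       iterate s x (suc t) ≡ x
  collision⇒periodic {x} i t eq = sym (iterate-injective s-injective i (begin
    iterate s x i                        ≡⟨ eq ⟩
    iterate s x (suc i + t)              ≡⟨ cong (iterate s x ∘ suc) (+-comm i t) ⟩
    iterate s x (suc t + i)              ≡⟨ iterate-+ s x (suc t) i ⟩
    iterate s (iterate s x (suc t)) i    ∎))
    where open ≡-Reasoning

  injective⇒periodic : ∀ x → ∃ λ t → iterate s x (suc t) ≡ x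
  injective⇒periodic x
    with i , j , i<j , eq ← pigeonhole (n<1+n m) (λ (k : Fin (suc m)) → iterate s x (toℕ k))
    with t , i+t≡j ← m≤n⇒∃[o]m+o≡n i<j
    = t , collision⇒periodic (toℕ i) t (trans eq (cong (iterate s x) (sym i+t≡j)))

  injective⇒surjective : StrictlySurjective _≡_ s
  injective⇒surjective x =
    let t , periodic = injective⇒periodic x
    in iterate s x t , trans (sym (iterate-suc s x t)) periodic

module _ (P : Poset c ℓ₁ ℓ₂) where
  open Poset P renaming (refl to ≤-refl; trans to ≤-trans)

  iterate-increasing : ∀ {s : A → A} {u : A → Carrier} → (∀ x → u x ≤ u (s x)) →
                       ∀ x k → u x ≤ u (iterate s x k)
  iterate-increasing increasing x zero    = ≤-refl
  iterate-increasing increasing x (suc k) =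
    ≤-trans (increasing x) (iterate-increasing increasing _ k)

  increasing-injective⇒invariant : ∀ {s : Fin m → Fin m} {u : Fin m → Carrier} →
    Injective _≡_ _≡_ s → (∀ x → u x ≤ u (s x)) → ∀ x → u (s x) ≈ u x
  increasing-injective⇒invariant {s = s} {u} s-injective increasing x =
    let t , periodic = injective⇒periodic s-injective x
    in antisym (subst (u (s x) ≤_) (cong u periodic) (iterate-increasing increasing (s x) t))
               (increasing x)

  _≼_ : (Fin n → Carrier) → (Fin m → Carrier) → Set ℓ₂
  _≼_ {n} {m} v u = Σ[ f ∈ (Fin m → Fin n) ] StrictlySurjective _≡_ f × (∀ i → v (f i) ≤ u i)

  ≼-trans : ∀ {o} {w : Fin o → Carrier} {v : Fin n → Carrier} {u : Fin m → Carrier} →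
            w ≼ v → v ≼ u → w ≼ u
  ≼-trans (f , f-surjective , f-≤) (g , g-surjective , g-≤) =
    f ∘ g ,
    (λ k → let j , fj≡k = f-surjective k ; i , gi≡j = g-surjective j
           in i , trans (cong f gi≡j) fj≡k) ,
    (λ i → ≤-trans (f-≤ (g i)) (g-≤ i))

  ≼⇒≤-section : ∀ {v : Fin n → Carrier} {u : Fin m → Carrier} →
                ((f , f-surjective , _) : v ≼ u) → ∀ j → v j ≤ u (section f-surjective j)
  ≼⇒≤-section {v = v} (f , f-surjective , f-≤) j =
    subst (_≤ _) (cong v (section-inverse f-surjective j)) (f-≤ (section f-surjective j))

  ≼-antisym : ∀ {v : Fin n → Carrier} {u : Fin m → Carrier} → v ≼ u → u ≼ v →
              Σ[ π ∈ Permutation m n ] (∀ i → u i ≈ v (π ⟨$⟩ʳ i))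
  ≼-antisym {n} {m} {v} {u} v≼u@(f , f-surjective , f-≤) u≼v@(_ , g-surjective , _) =
    permutation f f⁻ (section-inverse f-surjective) f⁻∘f , u≈v∘f
    where
    f⁻ = section f-surjective
    g⁻ = section g-surjective

    s : Fin m → Fin m
    s = f⁻ ∘ g⁻

    s-injective : Injective _≡_ _≡_ s
    s-injective eq = section-injective g-surjective (section-injective f-surjective eq)

    u≤v∘g⁻ : ∀ x → u x ≤ v (g⁻ x)
    u≤v∘g⁻ = ≼⇒≤-section {v = u} {u = v} u≼v

    u∘s≈u : ∀ x → u (s x) ≈ u x
    u∘s≈u = increasing-injective⇒invariant s-injective
              (λ x → ≤-trans (u≤v∘g⁻ x) (≼⇒≤-section {v = v} {u = u} v≼u (g⁻ x)))

    f∘s≡g⁻ : ∀ y → f (s y) ≡ g⁻ y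
    f∘s≡g⁻ y = section-inverse f-surjective (g⁻ y)

    f⁻∘f : ∀ i → f⁻ (f i) ≡ i
    f⁻∘f i with y , refl ← injective⇒surjective s-injective i = cong f⁻ (f∘s≡g⁻ y)

    u∘s≤v∘f∘s : ∀ y → u (s y) ≤ v (f (s y))
    u∘s≤v∘f∘s y = begin
      u (s y)      ≈⟨ u∘s≈u y ⟩
      u y          ≤⟨ u≤v∘g⁻ y ⟩
      v (g⁻ y)     ≡⟨ cong v (f∘s≡g⁻ y) ⟨
      v (f (s y))  ∎
      where open ≤-Reasoning P

    u≈v∘f : ∀ i → u i ≈ v (f i)
    u≈v∘f i with y , refl ← injective⇒surjective s-injective i = antisym (u∘s≤v∘f∘s y) (f-≤ (s y))

module _ (S : Setoid a ℓ) where
  open Setoid S using (Carrier; _≈_; reflexive) renaming (trans to ≈-trans)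
  open Permutation S using (_↭_; ↭-refl; ↭-sym; ↭-trans; ↭-prep; ↭-swap; ↭-reflexive; prep)

  tabulate-↭-punchIn : ∀ (g : Fin (suc n) → Carrier) k →
                       tabulate g ↭ g k ∷ tabulate (g ∘ punchIn k)
  tabulate-↭-punchIn         g zero    = ↭-refl
  tabulate-↭-punchIn {suc n} g (suc k) =
    ↭-trans (↭-prep (g zero) (tabulate-↭-punchIn (g ∘ suc) k)) (↭-swap _ _ ↭-refl)

  ↭-tabulate : ∀ {n} xs {g : Fin n → Carrier} (π : Permutation (length xs) n) →
               (∀ i → lookup xs i ≈ g (π ⟨$⟩ʳ i)) → xs ↭ tabulate g
  ↭-tabulate {zero}  []       π _ = ↭-refl
  ↭-tabulate {suc _} []       π _ = ⊥-elim (¬Fin0 (π ⟨$⟩ˡ zero))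
  ↭-tabulate {zero}  (_ ∷ _)  π _ = ⊥-elim (¬Fin0 (π ⟨$⟩ʳ zero))
  ↭-tabulate {suc _} (_ ∷ xs) {g} π xs≈g∘π =
    ↭-trans (prep (xs≈g∘π zero) (↭-tabulate xs (remove zero π) xs≈g∘π′))
            (↭-sym (tabulate-↭-punchIn g k))
    where
    k = π ⟨$⟩ʳ zero
    xs≈g∘π′ : ∀ i → lookup xs i ≈ g (punchIn k (remove zero π ⟨$⟩ʳ i))
    xs≈g∘π′ i = ≈-trans (xs≈g∘π (suc i)) (reflexive (cong g (punchIn-permute π zero i)))

  lookup-permutation⇒↭ : ∀ {xs ys} → Σ[ π ∈ Permutation (length xs) (length ys) ]
                           (∀ i → lookup xs i ≈ lookup ys (π ⟨$⟩ʳ i)) → xs ↭ ys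
  lookup-permutation⇒↭ {ys = ys} (π , xs≈ys∘π) =
    ↭-trans (↭-tabulate _ π xs≈ys∘π) (↭-reflexive (tabulate-lookup ys))

module _ (P : Poset c ℓ₁ ℓ₂) where
  open Poset P
  open Permutation Eq.setoid using (onIndices)
  open PermutationProperties Eq.setoid using (onIndices-lookup)

  ≈#⇒≪ : ∀ {M N} → _≈#_ P M N → _≪_ P M N
  ≈#⇒≪ {M} {N} M↭N =
    π ⟨$⟩ˡ_ ,
    (λ i → π ⟨$⟩ʳ i , inverseˡ π) ,
    (λ j → reflexive (Eq.trans (onIndices-lookup M↭N (π ⟨$⟩ˡ j))
                               (Eq.reflexive (cong (lookup N) (inverseʳ π)))))
    where π = onIndices M↭N

  ≪-trans : ∀ {L M N} → _≪_ P L M → _≪_ P M N → _≪_ P L N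
  ≪-trans {L} {M} {N} = ≼-trans P {w = lookup L} {lookup M} {lookup N}

  ≪-antisym : ∀ {M N} → _≪_ P M N → _≪_ P N M → _≈#_ P M N
  ≪-antisym {M} {N} M≪N N≪M =
    lookup-permutation⇒↭ Eq.setoid (≼-antisym P {v = lookup N} {lookup M} N≪M M≪N)

lemma2p10 : ∀ {c ℓ₁ ℓ₂ : Level} (P : Poset c ℓ₁ ℓ₂) → IsPartialOrder (_≈#_ P) (_≪_ P)
lemma2p10 P = record
  { isPreorder = record
    { isEquivalence = ↭-isEquivalence
    ; reflexive     = ≈#⇒≪ P
    ; trans         = λ {L} {M} {N} → ≪-trans P {L} {M} {N}
    }
  ; antisym = ≪-antisym P
  }
  where open Permutation (Poset.Eq.setoid P) using (↭-isEquivalence)
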